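{- Let $\Sigma$ be a well-formed LF signature, $\Gamma$ a context, and $\Theta$ the arity context induced by $\Sigma$ and $\Gamma$. If $\vdash\Gamma\ \mathrm{ctx}$ is derivable, then $\Gamma$ respects $\Theta$. If $\Gamma\vdash K\ \mathrm{kind}$ or $\Gamma\vdash A\ \mathrm{type}$ is derivable, then, respectively, $K$ or $A$ respects $\Theta$. If $\Gamma\vdash M\Leftarrow A$ is derivable, then $\Theta\vdash M:A^-$ is derivable. If $\Gamma\vdash R\Rightarrow A$ is derivable, then $\Theta\vdash R\Rightarrow A^-$ is derivable.
   Context: Canonical LF syntax: kinds $K::=\mathrm{Type}\mid\Pi x{:}A.K$; types $A::=P\mid\Pi x{:}A.B$; atomic types $P::=a\mid P\,M$; canonical terms $M::=R\mid\lambda x.M$; atomic terms $R::=c\mid x\mid R\,M$; signatures $\Sigma::=\cdot\mid\Sigma,c{:}A\mid\Sigma,a{:}K$; contexts $\Gamma::=\cdot\mid\Gamma,x{:}A$. Arity types: generated from $o$ by $\rightarrow$; erasure $P^-=o$, $(\Pi x{:}A_1.A_2)^-=A_1^-\rightarrow A_2^-$. Hereditary substitution $[\{\langle x,M,\alpha\rangle\}]E=E'$ replaces $x$ by $M$ in $E$ while normalizing any resulting $\beta$-redexes (indexed by the arity type $\alpha$). LF judgements (relative to fixed $\Sigma$, bound variables fresh for $\Gamma$): $\vdash\cdot\ \mathrm{ctx}$; $\vdash\Gamma,x{:}A\ \mathrm{ctx}$ if $\vdash\Gamma\ \mathrm{ctx}$, $\Gamma\vdash A\ \mathrm{type}$ and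 $x$ not in $\Gamma$. $\Gamma\vdash\mathrm{Type}\ \mathrm{kind}$; $\Gamma\vdash\Pi x{:}A.K\ \mathrm{kind}$ if $\Gamma\vdash A\ \mathrm{type}$ and $\Gamma,x{:}A\vdash K\ \mathrm{kind}$. $\Gamma\vdash P\ \mathrm{type}$ if $\Gamma\vdash P\Rightarrow\mathrm{Type}$; $\Gamma\vdash\Pi x{:}A_1.A_2\ \mathrm{type}$ if $\Gamma\vdash A_1\ \mathrm{type}$ and $\Gamma,x{:}A_1\vdash A_2\ \mathrm{type}$. $\Gamma\vdash a\Rightarrow K$ if $a{:}K\in\Sigma$; $\Gamma\vdash P\,M\Rightarrow K$ if $\Gamma\vdash P\Rightarrow\Pi x{:}A.K_1$, $\Gamma\vdash M\Leftarrow A$ and $[\{\langle x,M,A^-\rangle\}]K_1=K$. $\Gamma\vdash R\Leftarrow P$ if $\Gamma\vdash R\Rightarrow P$; $\Gamma\vdash\lambda x.M\Leftarrow\Pi x{:}A_1.A_2$ if $\Gamma,x{:}A_1\vdash M\Leftarrow A_2$. $\Gamma\vdash x\Rightarrow A$ if $x{:}A\in\Gamma$; $\Gamma\vdash c\Rightarrow A$ if $c{:}A\in\Sigma$; $\Gamma\vdash R\,M\Rightarrow A$ if $\Gamma\vdash R\Rightarrow\Pi x{:}A_1.A_2$, $\Gamma\vdash M\Leftarrow A_1$ and $[\{\langle x,M,A_1^-\rangle\}]A_2=A$. A signature is well-formed if its constants are distinct and each $c{:}A$ (resp. $a{:}K$) satisfies $\cdot\vdash A\ \mathrm{type}$ (resp.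 $\cdot\vdash K\ \mathrm{kind}$) relative to the preceding part. Arity contexts, arity typing and respecting: an arity context is a set of unique assignments of arity types to constants and variables; $\Theta_1\oplus\Theta_2$ is $\Theta_1$ plus assignments of $\Theta_2$ for unassigned symbols. $\Theta\vdash c\Rightarrow\alpha$, $\Theta\vdash x\Rightarrow\alpha$ if assigned; $\Theta\vdash R\,M\Rightarrow\alpha$ if $\Theta\vdash R\Rightarrow\alpha'\rightarrow\alpha$ and $\Theta\vdash M:\alpha'$; $\Theta\vdash\lambda x.M:\alpha_1\rightarrow\alpha_2$ if $\{x:\alpha_1\}\oplus\Theta\vdash M:\alpha_2$; $\Theta\vdash R:o$ if $\Theta\vdash R\Rightarrow o$. A kind/type respects $\Theta$ if it is $\mathrm{Type}$, or atomic with every canonical term in it arity-typable under $\Theta$, or $\Pi x{:}A.E'$ with $A$ respecting $\Theta$ and $E'$ respecting $\{x:A^-\}\oplus\Theta$; a context respects $\Theta$ if all its types do. The arity context induced by $\Sigma$ and $\Gamma$ contains $x:A^-$ for each $x{:}A\in\Gamma$ and $c:A^-$ for each $c{:}A\in\Sigma$. -}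

module Defs where

open import Data.Nat using (ℕ; zero; suc; _<_; _≤_)
open import Data.List using (List; []; _∷_; map)
open import Data.List.Membership.Propositional using (_∈_; _∉_)
open import Data.Product using (_×_; ∃; _,_)
open import Data.Unit using (⊤)

-- Canonical LF syntax, variables as de Bruijn indices (index 0 = the
-- most recently bound variable / the last entry of the context).

data Tm : Set
data At : Set

data Tm where
  atm : At → Tm
  lam : Tm → Tm

data At where
  con : ℕ → At
  var : ℕ → At
  app : At → Tm → At

data ATy : Set
data Ty  : Set

data ATy where
  fam  : ℕ → ATy
  tapp : ATy → Tm → ATy

data Ty where
  atp : ATy → Ty
  pi  : Ty → Ty → Ty          -- pi A B : B is under one binder

data Kind : Set where
  type : Kind
  kpi  : Ty → Kind → Kind     -- kpi A K : K is under one binder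

infixr 5 _⟶_
data Arity : Set where
  o   : Arity
  _⟶_ : Arity → Arity → Arity

erase : Ty → Arity
erase (atp P)   = o
erase (pi A B)  = erase A ⟶ erase B

shiftVar : ℕ → ℕ → ℕ
shiftVar zero    i       = suc i
shiftVar (suc c) zero    = zero
shiftVar (suc c) (suc i) = suc (shiftVar c i)

shiftTm  : ℕ → Tm → Tm
shiftAt  : ℕ → At → At

shiftTm c (atm R) = atm (shiftAt c R)
shiftTm c (lam M) = lam (shiftTm (suc c) M)

shiftAt c (con k)   = con k
shiftAt c (var i)   = var (shiftVar c i)
shiftAt c (app R M) = app (shiftAt c R) (shiftTm c M)

shiftATy : ℕ → ATy → ATy
shiftATy c (fam a)    = fam a
shiftATy c (tapp P M) = tapp (shiftATy c P) (shiftTm c M)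

shiftTy : ℕ → Ty → Ty
shiftTy c (atp P)  = atp (shiftATy c P)
shiftTy c (pi A B) = pi (shiftTy c A) (shiftTy (suc c) B)

wkTm : Tm → Tm
wkTm = shiftTm 0

wkTy : Ty → Ty
wkTy = shiftTy 0

-- Hereditary substitution [{⟨x,M,α⟩}]E = E', as inductive relations.
-- The substituted variable x is the de Bruijn index n; indices above n
-- are decremented (the binder of x disappears).

-- atomic term, result is atomic (head not substituted)
data HSubAt  : ℕ → Tm → Arity → At → At → Set
-- atomic term, head substituted: result is a canonical term with arity
data HSubAtH : ℕ → Tm → Arity → At → Tm → Arity → Set
data HSubTm  : ℕ → Tm → Arity → Tm → Tm → Set

data HSubAt where
  hs-con  : ∀ {n M α k} → HSubAt n M α (con k) (con k)
  hs-var< : ∀ {n M α i} → i < n → HSubAt n M α (var i) (var i)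
  hs-var> : ∀ {n M α j} → n ≤ j → HSubAt n M α (var (suc j)) (var j)
  hs-app  : ∀ {n M α R R' N N'} →
            HSubAt n M α R R' → HSubTm n M α N N' →
            HSubAt n M α (app R N) (app R' N')

data HSubAtH where
  hsh-var : ∀ {n M α} → HSubAtH n M α (var n) M α
  hsh-app : ∀ {n M α R N N' body M' α₁ α₂} →
            HSubAtH n M α R (lam body) (α₁ ⟶ α₂) →
            HSubTm n M α N N' →
            HSubTm 0 N' α₁ body M' →
            HSubAtH n M α (app R N) M' α₂

data HSubTm where
  hs-atm  : ∀ {n M α R R'} → HSubAt n M α R R' → HSubTm n M α (atm R) (atm R')
  hs-atmH : ∀ {n M α R M'} → HSubAtH n M α R M' o → HSubTm n M α (atm R) M'
  hs-lam  : ∀ {n M α N N'} → HSubTm (suc n) (wkTm M) α N N' →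
            HSubTm n M α (lam N) (lam N')

data HSubATy : ℕ → Tm → Arity → ATy → ATy → Set where
  hs-fam  : ∀ {n M α a} → HSubATy n M α (fam a) (fam a)
  hs-tapp : ∀ {n M α P P' N N'} → HSubATy n M α P P' → HSubTm n M α N N' →
            HSubATy n M α (tapp P N) (tapp P' N')

data HSubTy : ℕ → Tm → Arity → Ty → Ty → Set where
  hs-atp : ∀ {n M α P P'} → HSubATy n M α P P' → HSubTy n M α (atp P) (atp P')
  hs-pi  : ∀ {n M α A A' B B'} → HSubTy n M α A A' →
           HSubTy (suc n) (wkTm M) α B B' →
           HSubTy n M α (pi A B) (pi A' B')

data HSubK : ℕ → Tm → Arity → Kind → Kind → Set where
  hs-type : ∀ {n M α} → HSubK n M α type type
  hs-kpi  : ∀ {n M α A A' K K'} → HSubTy n M α A A' →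
            HSubK (suc n) (wkTm M) α K K' →
            HSubK n M α (kpi A K) (kpi A' K')

data Entry : Set where
  tcon : ℕ → Ty → Entry
  fcon : ℕ → Kind → Entry

entryName : Entry → ℕ
entryName (tcon c _) = c
entryName (fcon a _) = a

-- most recent declaration first
Sig : Set
Sig = List Entry

-- most recent variable first (index 0)
Ctx : Set
Ctx = List Ty

-- x:A ∈ Γ, with A weakened into the scope of the whole of Γ
data _∋_∶_ : Ctx → ℕ → Ty → Set where
  here  : ∀ {Γ A} → (A ∷ Γ) ∋ 0 ∶ wkTy A
  there : ∀ {Γ A B i} → Γ ∋ i ∶ A → (B ∷ Γ) ∋ suc i ∶ wkTy A

data ⊢ctx   (S : Sig) : Ctx → Set
data ⊢kind  (S : Sig) : Ctx → Kind → Set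
data ⊢type  (S : Sig) : Ctx → Ty → Set
data ⊢atyp⇒ (S : Sig) : Ctx → ATy → Kind → Set
data ⊢chk   (S : Sig) : Ctx → Tm → Ty → Set
data ⊢syn   (S : Sig) : Ctx → At → Ty → Set

data ⊢ctx S where
  ctx-nil  : ⊢ctx S []
  ctx-cons : ∀ {Γ A} → ⊢ctx S Γ → ⊢type S Γ A → ⊢ctx S (A ∷ Γ)

data ⊢kind S where
  kind-type : ∀ {Γ} → ⊢kind S Γ type
  kind-pi   : ∀ {Γ A K} → ⊢type S Γ A → ⊢kind S (A ∷ Γ) K → ⊢kind S Γ (kpi A K)

data ⊢type S where
  type-atp : ∀ {Γ P} → ⊢atyp⇒ S Γ P type → ⊢type S Γ (atp P)
  type-pi  : ∀ {Γ A₁ A₂} → ⊢type S Γ A₁ → ⊢type S (A₁ ∷ Γ) A₂ →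
             ⊢type S Γ (pi A₁ A₂)

data ⊢atyp⇒ S where
  atyp-fam : ∀ {Γ a K} → fcon a K ∈ S → ⊢atyp⇒ S Γ (fam a) K
  atyp-app : ∀ {Γ P M A K₁ K} → ⊢atyp⇒ S Γ P (kpi A K₁) → ⊢chk S Γ M A →
             HSubK 0 M (erase A) K₁ K → ⊢atyp⇒ S Γ (tapp P M) K

data ⊢chk S where
  chk-atm : ∀ {Γ R P} → ⊢syn S Γ R (atp P) → ⊢chk S Γ (atm R) (atp P)
  chk-lam : ∀ {Γ M A₁ A₂} → ⊢chk S (A₁ ∷ Γ) M A₂ → ⊢chk S Γ (lam M) (pi A₁ A₂)

data ⊢syn S where
  syn-var : ∀ {Γ i A} → Γ ∋ i ∶ A → ⊢syn S Γ (var i) A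
  syn-con : ∀ {Γ c A} → tcon c A ∈ S → ⊢syn S Γ (con c) A
  syn-app : ∀ {Γ R M A₁ A₂ A} → ⊢syn S Γ R (pi A₁ A₂) → ⊢chk S Γ M A₁ →
            HSubTy 0 M (erase A₁) A₂ A → ⊢syn S Γ (app R M) A

data WfSig : Sig → Set where
  wf-nil  : WfSig []
  wf-tcon : ∀ {S c A} → WfSig S → c ∉ map entryName S → ⊢type S [] A →
            WfSig (tcon c A ∷ S)
  wf-fcon : ∀ {S a K} → WfSig S → a ∉ map entryName S → ⊢kind S [] K →
            WfSig (fcon a K ∷ S)

-- Arity contexts: assignments to constants (by name) and to variables
-- (by de Bruijn index)

record ArCtx : Set where
  constructor arctx
  field
    consts : List (ℕ × Arity)
    vars   : List Arity
open ArCtx public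

_⊕ᵛ_ : Arity → ArCtx → ArCtx
α ⊕ᵛ Θ = arctx (consts Θ) (α ∷ vars Θ)

data _∋ᵛ_∶_ : List Arity → ℕ → Arity → Set where
  here  : ∀ {Δ α} → (α ∷ Δ) ∋ᵛ 0 ∶ α
  there : ∀ {Δ β i α} → Δ ∋ᵛ i ∶ α → (β ∷ Δ) ∋ᵛ suc i ∶ α

data _⊢ᵃ_⇒_ : ArCtx → At → Arity → Set
data _⊢ᵃ_∶_ : ArCtx → Tm → Arity → Set

data _⊢ᵃ_⇒_ where
  ar-con : ∀ {Θ c α} → (c , α) ∈ consts Θ → Θ ⊢ᵃ con c ⇒ α
  ar-var : ∀ {Θ i α} → vars Θ ∋ᵛ i ∶ α → Θ ⊢ᵃ var i ⇒ α
  ar-app : ∀ {Θ R M α' α} → Θ ⊢ᵃ R ⇒ (α' ⟶ α) → Θ ⊢ᵃ M ∶ α' →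
           Θ ⊢ᵃ app R M ⇒ α

data _⊢ᵃ_∶_ where
  ar-lam : ∀ {Θ M α₁ α₂} → (α₁ ⊕ᵛ Θ) ⊢ᵃ M ∶ α₂ → Θ ⊢ᵃ lam M ∶ (α₁ ⟶ α₂)
  ar-atm : ∀ {Θ R} → Θ ⊢ᵃ R ⇒ o → Θ ⊢ᵃ atm R ∶ o

RespATy : ArCtx → ATy → Set
RespATy Θ (fam a)    = ⊤
RespATy Θ (tapp P M) = RespATy Θ P × ∃ λ α → Θ ⊢ᵃ M ∶ α

RespTy : ArCtx → Ty → Set
RespTy Θ (atp P)  = RespATy Θ P
RespTy Θ (pi A B) = RespTy Θ A × RespTy (erase A ⊕ᵛ Θ) B

RespK : ArCtx → Kind → Set
RespK Θ type      = ⊤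
RespK Θ (kpi A K) = RespTy Θ A × RespK (erase A ⊕ᵛ Θ) K

RespCtx : ArCtx → Ctx → Set
RespCtx Θ Γ = ∀ {i A} → Γ ∋ i ∶ A → RespTy Θ A

sigArities : Sig → List (ℕ × Arity)
sigArities []             = []
sigArities (tcon c A ∷ S) = (c , erase A) ∷ sigArities S
sigArities (fcon a K ∷ S) = sigArities S

induced : Sig → Ctx → ArCtx
induced S Γ = arctx (sigArities S) (map erase Γ)

-- Arity typing is LF typing with the dependencies erased: every LF typing
-- rule becomes an arity typing rule once types are replaced by their
-- erasures, because erasure ignores the terms inside types and hence is
-- invariant under weakening and hereditary substitution. The only extra
-- ingredient is weakening of arity typing, needed because each type of a
-- context is formed in the shorter context preceding it.
module Submission where

open import Defs
open import Data.Nat using (ℕ; zero; suc)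
open import Data.Product using (_×_; _,_)
open import Data.List using (List; []; _∷_; map)
open import Data.List.Membership.Propositional using (_∈_)
open import Data.List.Relation.Unary.Any using (here; there)
open import Data.Unit using (tt)
open import Relation.Binary.PropositionalEquality using (_≡_; refl; sym; cong₂; subst)

erase-shiftTy : ∀ c A → erase (shiftTy c A) ≡ erase A
erase-shiftTy c (atp P)  = refl
erase-shiftTy c (pi A B) = cong₂ _⟶_ (erase-shiftTy c A) (erase-shiftTy (suc c) B)

erase-HSubTy : ∀ {n M α A A'} → HSubTy n M α A A' → erase A' ≡ erase A
erase-HSubTy (hs-atp _)   = refl
erase-HSubTy (hs-pi h h′) = cong₂ _⟶_ (erase-HSubTy h) (erase-HSubTy h′)

-- Inserts β at position c, matching shiftVar c; beyond the end of the
-- list nothing is inserted (no variable can refer there).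
insert : ℕ → Arity → List Arity → List Arity
insert zero    β Δ       = β ∷ Δ
insert (suc c) β []      = []
insert (suc c) β (γ ∷ Δ) = γ ∷ insert c β Δ

shiftVar-∋ᵛ : ∀ {Δ i α} c β → Δ ∋ᵛ i ∶ α → insert c β Δ ∋ᵛ shiftVar c i ∶ α
shiftVar-∋ᵛ zero    β x         = there x
shiftVar-∋ᵛ (suc c) β here      = here
shiftVar-∋ᵛ (suc c) β (there x) = there (shiftVar-∋ᵛ c β x)

shiftAt-⊢ᵃ : ∀ {Cs Δ R α} c β →
             arctx Cs Δ ⊢ᵃ R ⇒ α → arctx Cs (insert c β Δ) ⊢ᵃ shiftAt c R ⇒ α
shiftTm-⊢ᵃ : ∀ {Cs Δ M α} c β →
             arctx Cs Δ ⊢ᵃ M ∶ α → arctx Cs (insert c β Δ) ⊢ᵃ shiftTm c M ∶ α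
shiftAt-⊢ᵃ c β (ar-con x)   = ar-con x
shiftAt-⊢ᵃ c β (ar-var x)   = ar-var (shiftVar-∋ᵛ c β x)
shiftAt-⊢ᵃ c β (ar-app R M) = ar-app (shiftAt-⊢ᵃ c β R) (shiftTm-⊢ᵃ c β M)
shiftTm-⊢ᵃ c β (ar-lam M)   = ar-lam (shiftTm-⊢ᵃ (suc c) β M)
shiftTm-⊢ᵃ c β (ar-atm R)   = ar-atm (shiftAt-⊢ᵃ c β R)

shiftATy-resp : ∀ {Cs Δ} c β P →
                RespATy (arctx Cs Δ) P → RespATy (arctx Cs (insert c β Δ)) (shiftATy c P)
shiftATy-resp c β (fam a)    tt            = tt
shiftATy-resp c β (tapp P M) (rP , α , ⊢M) = shiftATy-resp c β P rP , α , shiftTm-⊢ᵃ c β ⊢M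

shiftTy-resp : ∀ {Cs Δ} c β A →
               RespTy (arctx Cs Δ) A → RespTy (arctx Cs (insert c β Δ)) (shiftTy c A)
shiftTy-resp c β (atp P) rP = shiftATy-resp c β P rP
shiftTy-resp {Cs} {Δ} c β (pi A B) (rA , rB) =
  shiftTy-resp c β A rA ,
  subst (λ γ → RespTy (arctx Cs (γ ∷ insert c β Δ)) (shiftTy (suc c) B))
        (sym (erase-shiftTy c A)) (shiftTy-resp (suc c) β B rB)

wkTy-resp : ∀ {Cs Δ} β A → RespTy (arctx Cs Δ) A → RespTy (arctx Cs (β ∷ Δ)) (wkTy A)
wkTy-resp = shiftTy-resp 0

sigArities-∈ : ∀ {S c A} → tcon c A ∈ S → (c , erase A) ∈ sigArities S
sigArities-∈ {tcon _ _ ∷ S} (here refl) = here refl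
sigArities-∈ {tcon _ _ ∷ S} (there c∈S) = there (sigArities-∈ c∈S)
sigArities-∈ {fcon _ _ ∷ S} (there c∈S) = sigArities-∈ c∈S

map-erase-∋ᵛ : ∀ {Γ i A} → Γ ∋ i ∶ A → map erase Γ ∋ᵛ i ∶ erase A
map-erase-∋ᵛ (here {A = A})    rewrite erase-shiftTy 0 A = here
map-erase-∋ᵛ (there {A = A} x) rewrite erase-shiftTy 0 A = there (map-erase-∋ᵛ x)

module _ {S : Sig} where

  ⊢kind⇒RespK    : ∀ {Γ K} → ⊢kind S Γ K → RespK (induced S Γ) K
  ⊢type⇒RespTy   : ∀ {Γ A} → ⊢type S Γ A → RespTy (induced S Γ) A
  ⊢atyp⇒RespATy  : ∀ {Γ P K} → ⊢atyp⇒ S Γ P K → RespATy (induced S Γ) P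
  ⊢chk⇒⊢ᵃ        : ∀ {Γ M A} → ⊢chk S Γ M A → induced S Γ ⊢ᵃ M ∶ erase A
  ⊢syn⇒⊢ᵃ        : ∀ {Γ R A} → ⊢syn S Γ R A → induced S Γ ⊢ᵃ R ⇒ erase A

  ⊢kind⇒RespK kind-type     = tt
  ⊢kind⇒RespK (kind-pi A K) = ⊢type⇒RespTy A , ⊢kind⇒RespK K

  ⊢type⇒RespTy (type-atp P)  = ⊢atyp⇒RespATy P
  ⊢type⇒RespTy (type-pi A B) = ⊢type⇒RespTy A , ⊢type⇒RespTy B

  ⊢atyp⇒RespATy (atyp-fam _) = tt
  ⊢atyp⇒RespATy (atyp-app {A = A} P M _) = ⊢atyp⇒RespATy P , erase A , ⊢chk⇒⊢ᵃ M

  ⊢chk⇒⊢ᵃ (chk-atm R) = ar-atm (⊢syn⇒⊢ᵃ R)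
  ⊢chk⇒⊢ᵃ (chk-lam M) = ar-lam (⊢chk⇒⊢ᵃ M)

  ⊢syn⇒⊢ᵃ (syn-var x) = ar-var (map-erase-∋ᵛ x)
  ⊢syn⇒⊢ᵃ (syn-con c) = ar-con (sigArities-∈ c)
  ⊢syn⇒⊢ᵃ {Γ} {app R M} (syn-app ⊢R ⊢M h) =
    subst (induced S Γ ⊢ᵃ app R M ⇒_) (sym (erase-HSubTy h)) (ar-app (⊢syn⇒⊢ᵃ ⊢R) (⊢chk⇒⊢ᵃ ⊢M))

  ⊢ctx⇒RespCtx : ∀ {Γ} → ⊢ctx S Γ → RespCtx (induced S Γ) Γ
  ⊢ctx⇒RespCtx (ctx-cons {A = B} _ ⊢B) here              = wkTy-resp (erase B) B (⊢type⇒RespTy ⊢B)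
  ⊢ctx⇒RespCtx (ctx-cons {A = B} ⊢Γ _) (there {A = A} x) = wkTy-resp (erase B) A (⊢ctx⇒RespCtx ⊢Γ x)

theorem2p13 : (S : Sig) → WfSig S →
    ((Γ : Ctx) → ⊢ctx S Γ → RespCtx (induced S Γ) Γ) ×
    ((Γ : Ctx) (K : Kind) → ⊢kind S Γ K → RespK (induced S Γ) K) ×
    ((Γ : Ctx) (A : Ty) → ⊢type S Γ A → RespTy (induced S Γ) A) ×
    ((Γ : Ctx) (M : Tm) (A : Ty) → ⊢chk S Γ M A → induced S Γ ⊢ᵃ M ∶ erase A) ×
    ((Γ : Ctx) (R : At) (A : Ty) → ⊢syn S Γ R A → induced S Γ ⊢ᵃ R ⇒ erase A)
theorem2p13 S _ =
  (λ _ → ⊢ctx⇒RespCtx) ,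
  (λ _ _ → ⊢kind⇒RespK) ,
  (λ _ _ → ⊢type⇒RespTy) ,
  (λ _ _ _ → ⊢chk⇒⊢ᵃ) ,
  (λ _ _ _ → ⊢syn⇒⊢ᵃ)
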